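{- For every integer $d\geq 4$, $$\sqrt{2}\,\mu_{K_{d+1}}\!\left(\frac{d+1}{\sqrt{2}}\right)^{1/(d+1)}<d,$$ where $K_{d+1}$ is the complete graph on $d+1$ vertices.
   Context: For a graph $H$ on $v(H)$ vertices, the matching polynomial is $\mu_H(z)=\sum_{k\geq 0}(-1)^k m_k(H) z^{v(H)-2k}$, where $m_k(H)$ is the number of matchings of $H$ with exactly $k$ edges ($m_0(H)=1$). In particular $m_k(K_n)=\frac{n!}{2^k k!(n-2k)!}$. -}

module Defs where

open import Data.Nat as ℕ using (ℕ; _!; _∸_)
open import Data.Nat.Properties using (_!≢0; m^n≢0; m*n≢0)
open import Data.Integer as ℤ using (ℤ; +_; -_)
open import Data.List using (List; map; upTo)
open import Data.List using () renaming (foldr to lfoldr)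

-- number of matchings with k edges in K_n : n! / (2^k k! (n-2k)!)
-- (only used for 2k ≤ n)
mK : ℕ → ℕ → ℕ
mK n k = ℕ._/_ (n !) (2 ℕ.^ k ℕ.* k ! ℕ.* (n ∸ 2 ℕ.* k) !)
  {{m*n≢0 (2 ℕ.^ k ℕ.* k !) ((n ∸ 2 ℕ.* k) !)
     {{m*n≢0 (2 ℕ.^ k) (k !) {{m^n≢0 2 k}} {{k !≢0}}}} {{(n ∸ 2 ℕ.* k) !≢0}}}}

sgn : ℕ → ℤ
sgn ℕ.zero = + 1
sgn (ℕ.suc k) = - sgn k

sumℤ : List ℤ → ℤ
sumℤ = lfoldr ℤ._+_ (+ 0)

-- scaledMuK n  =  2^(n/2) * μ_{K_n}(n / √2)
--              =  Σ_{0 ≤ k ≤ ⌊n/2⌋} (-1)^k m_k(K_n) n^(n-2k) 2^k   (an integer),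
-- since (n/√2)^(n-2k) * 2^(n/2) = n^(n-2k) * 2^k.
scaledMuK : ℕ → ℤ
scaledMuK n = sumℤ (map term (upTo (ℕ.suc (ℕ._/_ n 2))))
  where
  term : ℕ → ℤ
  term k = sgn k ℤ.* (+ (mK n k ℕ.* n ℕ.^ (n ∸ 2 ℕ.* k) ℕ.* 2 ℕ.^ k))

{-# OPTIONS --safe #-}
module Submission where

-- Put n = d + 1.  By the vertex-deletion recurrence for matchings of complete graphs, scaledMuK n
-- is the value at y = n of the Hermite sequence μ₀ = 1, μ₁ = y, μₘ₊₂ = y μₘ₊₁ − 2(m + 1) μₘ.
-- For n ≥ 8 we have 8(m + 1) ≤ n² when m < n, which makes the invariant n μₘ ≤ 2 μₘ₊₁ propagate
-- up to m = n; in particular every μₘ is positive.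
-- Feeding the recurrence into itself twice gives n³ μₘ₊₁ ≤ (n⁴ − decay m) μₘ with
-- decay m = 2m(n² + 2(m − 1)), so by telescoping and AM-GM
--   n³ⁿ μₙ ≤ ∏_{m<n} (n⁴ − decay m) ≤ (∑_{m<n} (n⁴ − decay m) / n)ⁿ.
-- Once n ≥ 12 we have ∑_{m<n} decay m > n⁴, whence μₙ < (n − 1)ⁿ.
-- The degrees 4 ≤ d ≤ 10 are decided by evaluation.

open import Defs
open import Data.Nat
open import Data.Nat.Properties
open import Data.Nat.DivMod
  using (_/_; _%_; /-congˡ; m*n/n≡m; m≡m%n+[m/n]*n; m%n<n; m/n*n≤m; m/n≤m)
open import Data.Nat.Tactic.RingSolver using (solve-∀; solve)
open import Algebra.Properties.CommutativeSemigroup *-commutativeSemigroup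
  using (interchange; x∙yz≈y∙xz; xy∙z≈y∙xz)
open import Algebra.Properties.CommutativeSemigroup +-commutativeSemigroup
  using () renaming (interchange to +-interchange)
open import Data.Integer as ℤ using (ℤ; +_; -_; 0ℤ)
import Data.Integer.Properties as ℤ
import Data.Integer.Tactic.RingSolver as ℤ
open import Data.Fin using (Fin; toℕ; fromℕ<)
open import Data.Fin.Properties using (all?; toℕ-fromℕ<)
open import Data.List using (applyUpTo; _∷_; [])
open import Data.List.Properties using (map-upTo)
open import Data.Product using (_×_; _,_)
open import Data.Sum using (inj₁; inj₂)
open import Data.Unit using (tt)
open import Function using (_∘_)
open import Relation.Nullary using (Dec; yes; no)
open import Relation.Nullary.Decidable using (toWitness; _×-dec_)
open import Relation.Binary.PropositionalEquality

m+o≡n⇒m≤n : ∀ {m n} o → m + o ≡ n → m ≤ n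
m+o≡n⇒m≤n {m} o refl = m≤m+n m o

m∸n≡1+m∸1+n : ∀ {m n} → n < m → m ∸ n ≡ suc (m ∸ suc n)
m∸n≡1+m∸1+n {suc m} (s≤s n≤m) = +-∸-assoc 1 n≤m

m≤2[m∸n] : ∀ {m} n → 2 * n ≤ m → m ≤ 2 * (m ∸ n)
m≤2[m∸n] n 2n≤m with m≤n⇒∃[o]m+o≡n 2n≤m
... | k , refl = begin
  2 * n + k              ≤⟨ m≤m+n (2 * n + k) k ⟩
  2 * n + k + k          ≡⟨ solve (n ∷ k ∷ []) ⟩
  2 * (n + k)            ≡⟨ cong (2 *_) (m+n∸m≡n n (n + k)) ⟨
  2 * (n + (n + k) ∸ n)  ≡⟨ cong (λ x → 2 * (x ∸ n)) (solve (n ∷ k ∷ [])) ⟩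
  2 * (2 * n + k ∸ n)    ∎
  where open ≤-Reasoning

0<n*a≤2*b⇒0<b : ∀ {n a b} → 0 < n → 0 < a → n * a ≤ 2 * b → 0 < b
0<n*a≤2*b⇒0<b {suc n} {suc a} {zero}  _ _ ()
0<n*a≤2*b⇒0<b {b = suc b}             _ _ _  = z<s

k≤n/2⇒2*k≤n : ∀ {n k} → k ≤ n / 2 → 2 * k ≤ n
k≤n/2⇒2*k≤n {n} {k} k≤n/2 = begin
  2 * k        ≤⟨ *-monoʳ-≤ 2 k≤n/2 ⟩
  2 * (n / 2)  ≡⟨ *-comm 2 (n / 2) ⟩
  n / 2 * 2    ≤⟨ m/n*n≤m n 2 ⟩
  n            ∎
  where open ≤-Reasoning

n/2<k⇒n<2*k : ∀ {n k} → n / 2 < k → n < 2 * k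
n/2<k⇒n<2*k {n} {k} n/2<k = begin-strict
  n                  ≡⟨ m≡m%n+[m/n]*n n 2 ⟩
  n % 2 + n / 2 * 2  <⟨ +-monoˡ-< (n / 2 * 2) (m%n<n n 2) ⟩
  suc (n / 2) * 2    ≤⟨ *-monoˡ-≤ 2 n/2<k ⟩
  k * 2              ≡⟨ *-comm k 2 ⟩
  2 * k              ∎
  where open ≤-Reasoning

^-distribʳ-* : ∀ m n o → (m * n) ^ o ≡ m ^ o * n ^ o
^-distribʳ-* m n zero    = refl
^-distribʳ-* m n (suc o) rewrite ^-distribʳ-* m n o = interchange m n (m ^ o) (n ^ o)

∑ : ℕ → (ℕ → ℕ) → ℕ
∑ zero    f = 0
∑ (suc n) f = ∑ n f + f n

∏ : ℕ → (ℕ → ℕ) → ℕ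
∏ zero    f = 1
∏ (suc n) f = ∏ n f * f n

2mn≤m²+n² : ∀ m n → 2 * (m * n) ≤ m * m + n * n
2mn≤m²+n² m n with ≤-total m n
... | inj₁ m≤n with m≤n⇒∃[o]m+o≡n m≤n
...   | k , refl = m+o≡n⇒m≤n (k * k) (solve (m ∷ k ∷ []))
2mn≤m²+n² m n | inj₂ n≤m with m≤n⇒∃[o]m+o≡n n≤m
...   | k , refl = m+o≡n⇒m≤n (k * k) (solve (n ∷ k ∷ []))

weighted-amgm : ∀ l a b → suc l * a * b ^ l ≤ a ^ suc l + l * b ^ suc l
weighted-amgm zero    a b = ≤-reflexive (unit a b)
  where
  unit : ∀ a b → 1 * a * 1 ≡ a * 1 + 0 * (b * 1)
  unit = solve-∀
weighted-amgm (suc l) a b = +-cancelʳ-≤ rest _ _ (begin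
    suc (suc l) * a * (b * bˡ) + rest
      ≡⟨ split l a b bˡ ⟩
    a * (suc l * a * bˡ) + suc l * bˡ * (2 * (a * b))
      ≤⟨ +-mono-≤ (*-monoʳ-≤ a (weighted-amgm l a b)) (*-monoʳ-≤ (suc l * bˡ) (2mn≤m²+n² a b)) ⟩
    a * (a ^ suc l + l * (b * bˡ)) + suc l * bˡ * (a * a + b * b)
      ≡⟨ merge l a b bˡ (a ^ suc l) ⟩
    a * a ^ suc l + suc l * (b * (b * bˡ)) + rest ∎)
  where
  open ≤-Reasoning
  bˡ = b ^ l
  rest = suc l * (a * a * bˡ) + l * a * (b * bˡ)
  split : ∀ l a b c → suc (suc l) * a * (b * c) + (suc l * (a * a * c) + l * a * (b * c))
                     ≡ a * (suc l * a * c) + suc l * c * (2 * (a * b))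
  split = solve-∀
  merge : ∀ l a b c d → a * (d + l * (b * c)) + suc l * c * (a * a + b * b)
                       ≡ a * d + suc l * (b * (b * c)) + (suc l * (a * a * c) + l * a * (b * c))
  merge = solve-∀

-- weighted-amgm at a = (x + s) l and b = s (l + 1).
amgm-step : ∀ l x s → suc l ^ suc l * x * s ^ l ≤ (x + s) ^ suc l * l ^ l
amgm-step zero x s = m+o≡n⇒m≤n s (unit x s)
  where
  unit : ∀ x s → 1 * 1 * x * 1 + s ≡ (x + s) * 1 * 1
  unit = solve-∀
amgm-step l@(suc _) x s = *-cancelˡ-≤ l (+-cancelʳ-≤ (l * b ^ suc l) _ _ (begin
    l * (suc l ^ suc l * x * s ^ l) + l * (b * b ^ l)
      ≡⟨ cong (λ z → l * (suc l ^ suc l * x * s ^ l) + l * (b * z)) (^-distribʳ-* s (suc l) l) ⟩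
    l * (suc l ^ suc l * x * s ^ l) + l * (b * (s ^ l * suc l ^ l))
      ≡⟨ collect l x s (suc l ^ l) (s ^ l) ⟩
    suc l * a * (s ^ l * suc l ^ l)
      ≡⟨ cong (suc l * a *_) (^-distribʳ-* s (suc l) l) ⟨
    suc l * a * b ^ l
      ≤⟨ weighted-amgm l a b ⟩
    a ^ suc l + l * b ^ suc l
      ≡⟨ cong (_+ l * b ^ suc l) (^-distribʳ-* (x + s) l (suc l)) ⟩
    (x + s) ^ suc l * (l * l ^ l) + l * b ^ suc l
      ≡⟨ cong (_+ l * b ^ suc l) (x∙yz≈y∙xz ((x + s) ^ suc l) l (l ^ l)) ⟩
    l * ((x + s) ^ suc l * l ^ l) + l * b ^ suc l ∎))
  where
  open ≤-Reasoning
  a = (x + s) * l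
  b = s * suc l
  collect : ∀ l x s c d → l * (suc l * c * x * d) + l * (s * suc l * (d * c))
                         ≡ suc l * ((x + s) * l) * (d * c)
  collect = solve-∀

amgm : ∀ n f → n ^ n * ∏ n f ≤ ∑ n f ^ n
amgm zero    f = ≤-refl
amgm (suc n) f = *-cancelˡ-≤ (n ^ n) {{nⁿ≢0 n}} (begin
    n ^ n * (suc n ^ suc n * (∏ n f * f n))  ≡⟨ regroup (n ^ n) (suc n ^ suc n) (∏ n f) (f n) ⟩
    suc n ^ suc n * f n * (n ^ n * ∏ n f)    ≤⟨ *-monoʳ-≤ (suc n ^ suc n * f n) (amgm n f) ⟩
    suc n ^ suc n * f n * ∑ n f ^ n          ≤⟨ amgm-step n (f n) (∑ n f) ⟩
    (f n + ∑ n f) ^ suc n * n ^ n            ≡⟨ cong (λ z → z ^ suc n * n ^ n) (+-comm (f n) _) ⟩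
    (∑ n f + f n) ^ suc n * n ^ n            ≡⟨ *-comm _ (n ^ n) ⟩
    n ^ n * (∑ n f + f n) ^ suc n            ∎)
  where
  open ≤-Reasoning
  nⁿ≢0 : ∀ n → NonZero (n ^ n)
  nⁿ≢0 zero    = _
  nⁿ≢0 (suc n) = m^n≢0 (suc n) (suc n)
  regroup : ∀ a b c d → a * (b * (c * d)) ≡ b * d * (a * c)
  regroup = solve-∀

-- m_k(K_m): the last vertex is either unmatched or matched to one of the other m + 1.
matchings : ℕ → ℕ → ℕ
matchings m             zero    = 1
matchings zero          (suc k) = 0
matchings (suc zero)    (suc k) = 0
matchings (suc (suc m)) (suc k) = matchings (suc m) (suc k) + suc m * matchings m k

matchings-vanish : ∀ m k → m < 2 * k → matchings m k ≡ 0
matchings-vanish zero          (suc k) _ = refl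
matchings-vanish (suc zero)    (suc k) _ = refl
matchings-vanish (suc (suc m)) (suc k) 2+m<2[1+k]
  rewrite matchings-vanish (suc m) (suc k) (<-trans (n<1+n (suc m)) 2+m<2[1+k])
        | matchings-vanish m k (s≤s⁻¹ (s≤s⁻¹ (subst (2 + m <_) (*-suc 2 k) 2+m<2[1+k])))
  = *-zeroʳ (suc m)

matchings-closedForm : ∀ k j → matchings (2 * k + j) k * (2 ^ k * k ! * j !) ≡ (2 * k + j) !
matchings-closedForm zero    j = unit (j !)
  where
  unit : ∀ x → 1 * (1 * 1 * x) ≡ x
  unit = solve-∀
matchings-closedForm (suc k) j =
  subst (λ m → matchings m (suc k) * (2 ^ suc k * suc k ! * j !) ≡ m !)
        (cong (_+ j) (sym (*-suc 2 k))) (closedForm-2+ j)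
  where
  open ≡-Reasoning
  2ᵏ = 2 ^ k
  k! = k !
  closedForm-2+ : ∀ j → let M = 2 * k + j in
                  matchings (2 + M) (suc k) * (2 ^ suc k * suc k ! * j !) ≡ (2 + M) !
  closedForm-2+ zero = begin
      (matchings (1 + M) (suc k) + suc M * B) * (2 * 2ᵏ * (suc k * k!) * 1)
        ≡⟨ cong (λ a → (a + suc M * B) * (2 * 2ᵏ * (suc k * k!) * 1))
                (matchings-vanish (1 + M) (suc k) 1+M<2[1+k]) ⟩
      (0 + suc M * B) * (2 * 2ᵏ * (suc k * k!) * 1)
        ≡⟨ rearrange k B 2ᵏ k! ⟩
      (2 + M) * ((1 + M) * (B * (2ᵏ * k! * 1)))
        ≡⟨ cong (λ x → (2 + M) * ((1 + M) * x)) (matchings-closedForm k 0) ⟩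
      (2 + M) ! ∎
    where
    M = 2 * k + 0
    B = matchings M k
    1+M<2[1+k] : 1 + M < 2 * suc k
    1+M<2[1+k] = subst (2 + M ≤_) (sym (*-suc 2 k)) (≤-reflexive (cong (_+_ 2) (+-identityʳ (2 * k))))
    rearrange : ∀ k B P F → (0 + suc (2 * k + 0) * B) * (2 * P * (suc k * F) * 1)
                          ≡ (2 + (2 * k + 0)) * ((1 + (2 * k + 0)) * (B * (P * F * 1)))
    rearrange = solve-∀
  closedForm-2+ (suc j) = begin
      (A + suc M * B) * (2 * 2ᵏ * (suc k * k!) * (suc j * j!))
        ≡⟨ expand k j A B 2ᵏ k! j! ⟩
      suc j * (A * (2 * 2ᵏ * (suc k * k!) * j!)) + suc M * (2 * suc k) * (B * (2ᵏ * k! * (suc j * j!)))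
        ≡⟨ cong₂ (λ x y → suc j * x + suc M * (2 * suc k) * y)
                 closedForm-A (matchings-closedForm k (suc j)) ⟩
      suc j * ((1 + M) * M !) + suc M * (2 * suc k) * M !
        ≡⟨ collect k j (M !) ⟩
      (2 + M) ! ∎
    where
    M = 2 * k + suc j
    A = matchings (1 + M) (suc k)
    B = matchings M k
    j! = j !
    closedForm-A : A * (2 * 2ᵏ * (suc k * k!) * j!) ≡ (1 + M) !
    closedForm-A = subst (λ m → matchings m (suc k) * (2 * 2ᵏ * (suc k * k!) * j!) ≡ m !)
                         (trans (cong (_+ j) (*-suc 2 k)) (cong suc (sym (+-suc (2 * k) j))))
                         (matchings-closedForm (suc k) j)
    expand : ∀ k j A B P F J →
             (A + suc (2 * k + suc j) * B) * (2 * P * (suc k * F) * (suc j * J))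
           ≡ suc j * (A * (2 * P * (suc k * F) * J))
             + suc (2 * k + suc j) * (2 * suc k) * (B * (P * F * (suc j * J)))
    expand = solve-∀
    collect : ∀ k j X → suc j * ((1 + (2 * k + suc j)) * X) + suc (2 * k + suc j) * (2 * suc k) * X
                      ≡ (2 + (2 * k + suc j)) * ((1 + (2 * k + suc j)) * X)
    collect = solve-∀

mK≡matchings : ∀ n k → 2 * k ≤ n → mK n k ≡ matchings n k
mK≡matchings n k 2k≤n = begin
    n ! / D                  ≡⟨ /-congˡ closedForm ⟨
    matchings n k * D / D    ≡⟨ m*n/n≡m (matchings n k) D ⟩
    matchings n k            ∎
  where
  open ≡-Reasoning
  D = 2 ^ k * k ! * (n ∸ 2 * k) !
  instance
    D≢0 : NonZero D
    D≢0 = m*n≢0 (2 ^ k * k !) _ {{m*n≢0 (2 ^ k) (k !) {{m^n≢0 2 k}} {{k !≢0}}}} {{(n ∸ 2 * k) !≢0}}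
  closedForm : matchings n k * D ≡ n !
  closedForm = subst (λ m → matchings m k * D ≡ m !) (m+[n∸m]≡n 2k≤n)
                     (matchings-closedForm k (n ∸ 2 * k))

∑ℤ : ℕ → (ℕ → ℤ) → ℤ
∑ℤ n f = sumℤ (applyUpTo f n)

∑ℤ-cong : ∀ n {f g : ℕ → ℤ} → (∀ k → k < n → f k ≡ g k) → ∑ℤ n f ≡ ∑ℤ n g
∑ℤ-cong zero    f≗g = refl
∑ℤ-cong (suc n) f≗g = cong₂ ℤ._+_ (f≗g 0 z<s) (∑ℤ-cong n (λ k k<n → f≗g (suc k) (s<s k<n)))

∑ℤ-linear : ∀ n a b (f g : ℕ → ℤ) →
            ∑ℤ n (λ k → a ℤ.* f k ℤ.- b ℤ.* g k) ≡ a ℤ.* ∑ℤ n f ℤ.- b ℤ.* ∑ℤ n g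
∑ℤ-linear zero    a b f g = ℤ.solve (a ∷ b ∷ [])
∑ℤ-linear (suc n) a b f g =
  trans (cong (ℤ._+_ (a ℤ.* f 0 ℤ.- b ℤ.* g 0)) (∑ℤ-linear n a b (f ∘ suc) (g ∘ suc)))
        (regroup a b (f 0) (g 0) (∑ℤ n (f ∘ suc)) (∑ℤ n (g ∘ suc)))
  where
  regroup : ∀ a b x y X Y → a ℤ.* x ℤ.- b ℤ.* y ℤ.+ (a ℤ.* X ℤ.- b ℤ.* Y)
                          ≡ a ℤ.* (x ℤ.+ X) ℤ.- b ℤ.* (y ℤ.+ Y)
  regroup = ℤ.solve-∀

∑ℤ-snoc : ∀ n (f : ℕ → ℤ) → ∑ℤ (suc n) f ≡ ∑ℤ n f ℤ.+ f n
∑ℤ-snoc zero    f = ℤ.+-comm (f 0) 0ℤ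
∑ℤ-snoc (suc n) f = trans (cong (ℤ._+_ (f 0)) (∑ℤ-snoc n (f ∘ suc))) (sym (ℤ.+-assoc (f 0) _ _))

∑ℤ-pad : ∀ (f : ℕ → ℤ) {m n} → m ≤ n → (∀ k → m ≤ k → f k ≡ 0ℤ) → ∑ℤ n f ≡ ∑ℤ m f
∑ℤ-pad f {m} m≤n tail≡0 = go (≤⇒≤′ m≤n)
  where
  go : ∀ {n} → m ≤′ n → ∑ℤ n f ≡ ∑ℤ m f
  go (≤′-reflexive refl) = refl
  go (≤′-step {n} m≤′n) = begin
    ∑ℤ (suc n) f     ≡⟨ ∑ℤ-snoc n f ⟩
    ∑ℤ n f ℤ.+ f n   ≡⟨ cong₂ ℤ._+_ (go m≤′n) (tail≡0 n (≤′⇒≤ m≤′n)) ⟩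
    ∑ℤ m f ℤ.+ 0ℤ    ≡⟨ ℤ.+-identityʳ _ ⟩
    ∑ℤ m f           ∎
    where open ≡-Reasoning

μterm : ℕ → ℕ → ℕ → ℤ
μterm y m k = sgn k ℤ.* + (matchings m k * y ^ (m ∸ 2 * k) * 2 ^ k)

-- μ y m = 2^{m/2} μ_{K_m}(y/√2).
μ : ℕ → ℕ → ℤ
μ y m = ∑ℤ (suc m) (μterm y m)

μterm-zero : ∀ y m → μterm y m 0 ≡ + (y ^ m)
μterm-zero y m = trans (ℤ.*-identityˡ _) (cong +_ (unit (y ^ m)))
  where
  unit : ∀ x → 1 * x * 1 ≡ x
  unit = solve-∀

μterm-vanish : ∀ y m k → m < 2 * k → μterm y m k ≡ 0ℤ
μterm-vanish y m k m<2k rewrite matchings-vanish m k m<2k = ℤ.*-zeroʳ (sgn k)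

μterm-beyond : ∀ y m k → m < k → μterm y m k ≡ 0ℤ
μterm-beyond y m k m<k = μterm-vanish y m k (≤-trans m<k (m≤n*m k 2))

matchings-pow-peel : ∀ y m k → let a = matchings (suc m) (suc k) in
                     a * y ^ (m ∸ 2 * k) ≡ y * (a * y ^ (m ∸ suc (2 * k)))
matchings-pow-peel y m k with suc (2 * k) ≤? m
... | yes 2k<m rewrite m∸n≡1+m∸1+n 2k<m = x∙yz≈y∙xz (matchings (suc m) (suc k)) y _
... | no  2k≮m
  rewrite matchings-vanish (suc m) (suc k) (subst (suc m <_) (sym (*-suc 2 k)) (s≤s (≰⇒> 2k≮m)))
  = sym (*-zeroʳ y)

μterm-rec-zero : ∀ y m → μterm y (2 + m) 0 ≡ + y ℤ.* μterm y (1 + m) 0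
μterm-rec-zero y m = begin
  μterm y (2 + m) 0           ≡⟨ μterm-zero y (2 + m) ⟩
  + (y * y ^ suc m)           ≡⟨ ℤ.pos-* y (y ^ suc m) ⟩
  + y ℤ.* + (y ^ suc m)       ≡⟨ cong (ℤ._*_ (+ y)) (μterm-zero y (1 + m)) ⟨
  + y ℤ.* μterm y (1 + m) 0   ∎
  where open ≡-Reasoning

μterm-rec : ∀ y m k →
  μterm y (2 + m) (suc k) ≡ + y ℤ.* μterm y (1 + m) (suc k) ℤ.- + (2 * suc m) ℤ.* μterm y m k
μterm-rec y m k = begin
    μterm y (2 + m) (suc k)
      ≡⟨ cong (λ e → - s ℤ.* + ((A + suc m * B) * y ^ e * (2 * P))) (cong (2 + m ∸_) (*-suc 2 k)) ⟩
    - s ℤ.* + ((A + suc m * B) * Y * (2 * P))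
      ≡⟨ cong (λ x → - s ℤ.* + x) unfolded ⟩
    - s ℤ.* + (y * (A * Z * (2 * P)) + 2 * suc m * (B * Y * P))
      ≡⟨ cong (ℤ._*_ (- s)) (cong₂ ℤ._+_ (ℤ.pos-* y _) (ℤ.pos-* (2 * suc m) _)) ⟩
    - s ℤ.* (+ y ℤ.* + (A * Z * (2 * P)) ℤ.+ + (2 * suc m) ℤ.* + (B * Y * P))
      ≡⟨ distribute (+ y) (+ (2 * suc m)) s (+ (A * Z * (2 * P))) (+ (B * Y * P)) ⟩
    + y ℤ.* (- s ℤ.* + (A * Z * (2 * P))) ℤ.- + (2 * suc m) ℤ.* (s ℤ.* + (B * Y * P))
      ≡⟨ cong (λ e → + y ℤ.* (- s ℤ.* + (A * y ^ e * (2 * P))) ℤ.- + (2 * suc m) ℤ.* μterm y m k)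
              (cong (1 + m ∸_) (*-suc 2 k)) ⟨
    + y ℤ.* μterm y (1 + m) (suc k) ℤ.- + (2 * suc m) ℤ.* μterm y m k ∎
  where
  open ≡-Reasoning
  s = sgn k
  A = matchings (suc m) (suc k)
  B = matchings m k
  P = 2 ^ k
  Y = y ^ (m ∸ 2 * k)
  Z = y ^ (m ∸ suc (2 * k))
  unfolded : (A + suc m * B) * Y * (2 * P) ≡ y * (A * Z * (2 * P)) + 2 * suc m * (B * Y * P)
  unfolded = begin
    (A + suc m * B) * Y * (2 * P)
      ≡⟨ expand m A B Y P ⟩
    A * Y * (2 * P) + 2 * suc m * (B * Y * P)
      ≡⟨ cong (λ x → x * (2 * P) + 2 * suc m * (B * Y * P)) (matchings-pow-peel y m k) ⟩
    y * (A * Z) * (2 * P) + 2 * suc m * (B * Y * P)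
      ≡⟨ cong (_+ 2 * suc m * (B * Y * P)) (*-assoc y (A * Z) (2 * P)) ⟩
    y * (A * Z * (2 * P)) + 2 * suc m * (B * Y * P) ∎
    where
    expand : ∀ m A B Y P → (A + suc m * B) * Y * (2 * P) ≡ A * Y * (2 * P) + 2 * suc m * (B * Y * P)
    expand = solve-∀
  distribute : ∀ a c s u v →
               - s ℤ.* (a ℤ.* u ℤ.+ c ℤ.* v) ≡ a ℤ.* (- s ℤ.* u) ℤ.- c ℤ.* (s ℤ.* v)
  distribute = ℤ.solve-∀

μ-rec : ∀ y m → μ y (2 + m) ≡ + y ℤ.* μ y (1 + m) ℤ.- + (2 * suc m) ℤ.* μ y m
μ-rec y m = begin
    μterm y (2 + m) 0 ℤ.+ ∑ℤ (2 + m) (μterm y (2 + m) ∘ suc)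
      ≡⟨ cong₂ ℤ._+_ (μterm-rec-zero y m) (∑ℤ-cong (2 + m) (λ k _ → μterm-rec y m k)) ⟩
    + y ℤ.* a₀ ℤ.+ ∑ℤ (2 + m) (λ k → + y ℤ.* μterm y (1 + m) (suc k) ℤ.- c ℤ.* μterm y m k)
      ≡⟨ cong (ℤ._+_ (+ y ℤ.* a₀)) (∑ℤ-linear (2 + m) (+ y) c (μterm y (1 + m) ∘ suc) (μterm y m)) ⟩
    + y ℤ.* a₀ ℤ.+ (+ y ℤ.* ∑ℤ (2 + m) (μterm y (1 + m) ∘ suc)
                    ℤ.- c ℤ.* ∑ℤ (2 + m) (μterm y m))
      ≡⟨ regroup (+ y) c a₀ _ _ ⟩
    + y ℤ.* ∑ℤ (3 + m) (μterm y (1 + m)) ℤ.- c ℤ.* ∑ℤ (2 + m) (μterm y m)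
      ≡⟨ cong₂ (λ a b → + y ℤ.* a ℤ.- c ℤ.* b)
               (∑ℤ-pad (μterm y (1 + m)) (n≤1+n _) (μterm-beyond y (1 + m)))
               (∑ℤ-pad (μterm y m) (n≤1+n _) (μterm-beyond y m)) ⟩
    + y ℤ.* μ y (1 + m) ℤ.- c ℤ.* μ y m ∎
  where
  open ≡-Reasoning
  a₀ = μterm y (1 + m) 0
  c = + (2 * suc m)
  regroup : ∀ y c a A B → y ℤ.* a ℤ.+ (y ℤ.* A ℤ.- c ℤ.* B) ≡ y ℤ.* (a ℤ.+ A) ℤ.- c ℤ.* B
  regroup = ℤ.solve-∀

scaledMuK≡μ : ∀ n → scaledMuK n ≡ μ n n
scaledMuK≡μ n = begin
    scaledMuK n
      ≡⟨ cong sumℤ (map-upTo term (suc (n / 2))) ⟩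
    ∑ℤ (suc (n / 2)) term
      ≡⟨ ∑ℤ-cong (suc (n / 2)) term≡μterm ⟩
    ∑ℤ (suc (n / 2)) (μterm n n)
      ≡⟨ ∑ℤ-pad (μterm n n) (s≤s (m/n≤m n 2)) μterm-beyond-n/2 ⟨
    μ n n ∎
  where
  open ≡-Reasoning
  term : ℕ → ℤ
  term k = sgn k ℤ.* + (mK n k * n ^ (n ∸ 2 * k) * 2 ^ k)
  term≡μterm : ∀ k → k < suc (n / 2) → term k ≡ μterm n n k
  term≡μterm k (s≤s k≤n/2) =
    cong (λ a → sgn k ℤ.* + (a * n ^ (n ∸ 2 * k) * 2 ^ k)) (mK≡matchings n k (k≤n/2⇒2*k≤n k≤n/2))
  μterm-beyond-n/2 : ∀ k → n / 2 < k → μterm n n k ≡ 0ℤ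
  μterm-beyond-n/2 k n/2<k = μterm-vanish n n k (n/2<k⇒n<2*k n/2<k)

-- For y = n and m ≤ n the truncated subtraction is exact (Bounds.μℕ-no-truncation).
μℕ : ℕ → ℕ → ℕ
μℕ y zero          = 1
μℕ y (suc zero)    = y
μℕ y (suc (suc m)) = y * μℕ y (suc m) ∸ 2 * suc m * μℕ y m

module Bounds (n : ℕ) (8≤n : 8 ≤ n) where

  private
    g : ℕ → ℕ
    g = μℕ n

    n³ n⁴ : ℕ
    n³ = n * n * n
    n⁴ = n * n³

    0<n : 0 < n
    0<n = <-≤-trans z<s 8≤n

    instance
      n≢0 : NonZero n
      n≢0 = >-nonZero 0<n

  ratio-invariant-step : ∀ m → suc (suc m) ≤ n → n * g m ≤ 2 * g (suc m) →
                         2 * (2 * suc m * g m) ≤ n * g (suc m)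
  ratio-invariant-step m 2+m≤n ng≤2g′ = *-cancelˡ-≤ 2 (begin
      2 * (2 * (2 * suc m * g m))  ≡⟨ eight (suc m) (g m) ⟩
      8 * suc m * g m              ≤⟨ *-monoˡ-≤ (g m) 8[1+m]≤n² ⟩
      n * n * g m                  ≡⟨ *-assoc n n (g m) ⟩
      n * (n * g m)                ≤⟨ *-monoʳ-≤ n ng≤2g′ ⟩
      n * (2 * g (suc m))          ≡⟨ x∙yz≈y∙xz n 2 (g (suc m)) ⟩
      2 * (n * g (suc m))          ∎)
    where
    open ≤-Reasoning
    eight : ∀ a b → 2 * (2 * (2 * a * b)) ≡ 8 * a * b
    eight = solve-∀
    8[1+m]≤n² : 8 * suc m ≤ n * n
    8[1+m]≤n² = *-mono-≤ 8≤n (<⇒≤ 2+m≤n)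

  ratio-invariant : ∀ m → suc m ≤ n → n * g m ≤ 2 * g (suc m)
  ratio-invariant zero    _     = ≤-trans (≤-reflexive (*-identityʳ n)) (m≤n*m n 2)
  ratio-invariant (suc m) 2+m≤n =
    m≤2[m∸n] (2 * suc m * g m) (ratio-invariant-step m 2+m≤n (ratio-invariant m (<⇒≤ 2+m≤n)))

  μℕ-pos : ∀ m → m ≤ n → 0 < g m
  μℕ-pos zero    _     = z<s
  μℕ-pos (suc m) 1+m≤n = 0<n*a≤2*b⇒0<b 0<n (μℕ-pos m (<⇒≤ 1+m≤n)) (ratio-invariant m 1+m≤n)

  μℕ-no-truncation : ∀ m → suc (suc m) ≤ n → 2 * suc m * g m ≤ n * g (suc m)
  μℕ-no-truncation m 2+m≤n =
    ≤-trans (m≤n*m _ 2) (ratio-invariant-step m 2+m≤n (ratio-invariant m (<⇒≤ 2+m≤n)))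

  μℕ-rec : ∀ m → suc (suc m) ≤ n → g (2 + m) + 2 * suc m * g m ≡ n * g (suc m)
  μℕ-rec m 2+m≤n = m∸n+n≡m (μℕ-no-truncation m 2+m≤n)

  μℕ-suc≤ : ∀ m → g (suc m) ≤ n * g m
  μℕ-suc≤ zero    = ≤-reflexive (sym (*-identityʳ n))
  μℕ-suc≤ (suc m) = m∸n≤m (n * g (suc m)) (2 * suc m * g m)

  μℕ-decay₁ : ∀ m → suc m ≤ n → n * g (suc m) + 2 * m * g m ≤ n * n * g m
  μℕ-decay₁ zero    _     = ≤-reflexive (base n)
    where
    base : ∀ n → n * n + 2 * 0 * 1 ≡ n * n * 1
    base = solve-∀
  μℕ-decay₁ (suc m) 2+m≤n = begin
      n * g (2 + m) + 2 * suc m * g (suc m)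
        ≤⟨ +-monoʳ-≤ (n * g (2 + m)) (*-monoʳ-≤ (2 * suc m) (μℕ-suc≤ m)) ⟩
      n * g (2 + m) + 2 * suc m * (n * g m)
        ≡⟨ factor n (g (2 + m)) (suc m) (g m) ⟩
      n * (g (2 + m) + 2 * suc m * g m)
        ≡⟨ cong (n *_) (μℕ-rec m 2+m≤n) ⟩
      n * (n * g (suc m))
        ≡⟨ *-assoc n n (g (suc m)) ⟨
      n * n * g (suc m) ∎
    where
    open ≤-Reasoning
    factor : ∀ n a b c → n * a + 2 * b * (n * c) ≡ n * (a + 2 * b * c)
    factor = solve-∀

  μℕ-decay₁-scaled : ∀ m → suc m ≤ n → (n * n + 2 * m) * g (suc m) ≤ n³ * g m
  μℕ-decay₁-scaled m 1+m≤n = *-cancelˡ-≤ n (+-cancelʳ-≤ extra _ _ (begin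
      n * ((n * n + 2 * m) * b) + extra
        ≤⟨ m≤m+n _ (4 * m * m * a) ⟩
      n * ((n * n + 2 * m) * b) + extra + 4 * m * m * a
        ≡⟨ expand n m a b ⟩
      (n * n + 2 * m) * (n * b + 2 * m * a)
        ≤⟨ *-monoʳ-≤ (n * n + 2 * m) (μℕ-decay₁ m 1+m≤n) ⟩
      (n * n + 2 * m) * (n * n * a)
        ≡⟨ collect n m a ⟩
      n * (n³ * a) + extra ∎))
    where
    open ≤-Reasoning
    a = g m
    b = g (suc m)
    extra = 2 * m * (n * n) * a
    expand : ∀ n m a b → n * ((n * n + 2 * m) * b) + 2 * m * (n * n) * a + 4 * m * m * a
                       ≡ (n * n + 2 * m) * (n * b + 2 * m * a)
    expand = solve-∀
    collect : ∀ n m a → (n * n + 2 * m) * (n * n * a) ≡ n * (n * n * n * a) + 2 * m * (n * n) * a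
    collect = solve-∀

  decay : ℕ → ℕ
  decay m = 2 * m * (n * n + 2 * pred m)

  μℕ-decay₂ : ∀ m → suc m ≤ n → n³ * g (suc m) + decay m * g m ≤ n⁴ * g m
  μℕ-decay₂ zero    _     = ≤-reflexive (base n)
    where
    base : ∀ n → n * n * n * n + 0 ≡ n * (n * n * n) * 1
    base = solve-∀
  μℕ-decay₂ (suc m) 2+m≤n = begin
      n³ * g (2 + m) + decay (suc m) * g (suc m)
        ≡⟨ cong (_+_ (n³ * g (2 + m))) (*-assoc (2 * suc m) (n * n + 2 * m) (g (suc m))) ⟩
      n³ * g (2 + m) + 2 * suc m * ((n * n + 2 * m) * g (suc m))
        ≤⟨ +-monoʳ-≤ (n³ * g (2 + m))
                     (*-monoʳ-≤ (2 * suc m) (μℕ-decay₁-scaled m (<⇒≤ 2+m≤n))) ⟩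
      n³ * g (2 + m) + 2 * suc m * (n³ * g m)
        ≡⟨ factor n³ (g (2 + m)) (suc m) (g m) ⟩
      n³ * (g (2 + m) + 2 * suc m * g m)
        ≡⟨ cong (n³ *_) (μℕ-rec m 2+m≤n) ⟩
      n³ * (n * g (suc m))
        ≡⟨ regroup n (g (suc m)) ⟩
      n⁴ * g (suc m) ∎
    where
    open ≤-Reasoning
    factor : ∀ N a b c → N * a + 2 * b * (N * c) ≡ N * (a + 2 * b * c)
    factor = solve-∀
    regroup : ∀ n a → n * n * n * (n * a) ≡ n * (n * n * n) * a
    regroup = solve-∀

  rate : ℕ → ℕ
  rate m = n⁴ ∸ decay m

  rate+decay : ∀ m → suc m ≤ n → rate m + decay m ≡ n⁴
  rate+decay m 1+m≤n = m∸n+n≡m decay≤n⁴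
    where
    instance
      gₘ≢0 : NonZero (g m)
      gₘ≢0 = >-nonZero (μℕ-pos m (<⇒≤ 1+m≤n))
    decay≤n⁴ : decay m ≤ n⁴
    decay≤n⁴ = *-cancelʳ-≤ (decay m) n⁴ (g m) (≤-trans (m≤n+m _ _) (μℕ-decay₂ m 1+m≤n))

  μℕ-ratio : ∀ m → suc m ≤ n → n³ * g (suc m) ≤ rate m * g m
  μℕ-ratio m 1+m≤n = +-cancelʳ-≤ (decay m * g m) _ _ (begin
      n³ * g (suc m) + decay m * g m  ≤⟨ μℕ-decay₂ m 1+m≤n ⟩
      n⁴ * g m                        ≡⟨ cong (_* g m) (rate+decay m 1+m≤n) ⟨
      (rate m + decay m) * g m        ≡⟨ *-distribʳ-+ (g m) (rate m) (decay m) ⟩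
      rate m * g m + decay m * g m    ∎)
    where open ≤-Reasoning

  μℕ-telescope : ∀ M → M ≤ n → n³ ^ M * g M ≤ ∏ M rate
  μℕ-telescope zero    _     = ≤-refl
  μℕ-telescope (suc M) 1+M≤n = begin
      n³ * n³ ^ M * g (suc M)      ≡⟨ xy∙z≈y∙xz n³ (n³ ^ M) (g (suc M)) ⟩
      n³ ^ M * (n³ * g (suc M))    ≤⟨ *-monoʳ-≤ (n³ ^ M) (μℕ-ratio M 1+M≤n) ⟩
      n³ ^ M * (rate M * g M)      ≡⟨ x∙yz≈y∙xz (n³ ^ M) (rate M) (g M) ⟩
      rate M * (n³ ^ M * g M)      ≤⟨ *-monoʳ-≤ (rate M) (μℕ-telescope M (<⇒≤ 1+M≤n)) ⟩
      rate M * ∏ M rate            ≡⟨ *-comm (rate M) (∏ M rate) ⟩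
      ∏ M rate * rate M            ∎
    where open ≤-Reasoning

  ∑rate+∑decay : ∀ M → M ≤ n → ∑ M rate + ∑ M decay ≡ M * n⁴
  ∑rate+∑decay zero    _     = refl
  ∑rate+∑decay (suc M) 1+M≤n = begin
      ∑ M rate + rate M + (∑ M decay + decay M)
        ≡⟨ +-interchange (∑ M rate) (rate M) (∑ M decay) (decay M) ⟩
      (∑ M rate + ∑ M decay) + (rate M + decay M)
        ≡⟨ cong₂ _+_ (∑rate+∑decay M (<⇒≤ 1+M≤n)) (rate+decay M 1+M≤n) ⟩
      M * n⁴ + n⁴
        ≡⟨ +-comm (M * n⁴) n⁴ ⟩
      suc M * n⁴ ∎
    where open ≡-Reasoning

  ∑decay-closedForm : ∀ N → 3 * ∑ N decay + 3 * (n * n) * N + 12 * (N * N)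
                          ≡ 3 * (n * n) * (N * N) + 4 * (N * N * N) + 8 * N
  ∑decay-closedForm zero          = solve (n ∷ [])
  ∑decay-closedForm (suc zero)    = solve (n ∷ [])
  ∑decay-closedForm (suc (suc N)) = begin
      3 * (S + decay (suc N)) + 3 * (n * n) * (2 + N) + 12 * ((2 + N) * (2 + N))
        ≡⟨ split n N S ⟩
      3 * S + 3 * (n * n) * suc N + 12 * (suc N * suc N) + δ
        ≡⟨ cong (_+ δ) (∑decay-closedForm (suc N)) ⟩
      3 * (n * n) * (suc N * suc N) + 4 * (suc N * suc N * suc N) + 8 * suc N + δ
        ≡⟨ grow n N ⟩
      3 * (n * n) * ((2 + N) * (2 + N)) + 4 * ((2 + N) * (2 + N) * (2 + N)) + 8 * (2 + N) ∎
    where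
    open ≡-Reasoning
    S = ∑ (suc N) decay
    δ = 6 * suc N * (n * n + 2 * N) + 3 * (n * n) + 12 * (3 + 2 * N)
    split : ∀ n N S →
            3 * (S + 2 * suc N * (n * n + 2 * N)) + 3 * (n * n) * (2 + N) + 12 * ((2 + N) * (2 + N))
          ≡ 3 * S + 3 * (n * n) * suc N + 12 * (suc N * suc N)
            + (6 * suc N * (n * n + 2 * N) + 3 * (n * n) + 12 * (3 + 2 * N))
    split = solve-∀
    grow : ∀ n N → 3 * (n * n) * (suc N * suc N) + 4 * (suc N * suc N * suc N) + 8 * suc N
                   + (6 * suc N * (n * n + 2 * N) + 3 * (n * n) + 12 * (3 + 2 * N))
                 ≡ 3 * (n * n) * ((2 + N) * (2 + N)) + 4 * ((2 + N) * (2 + N) * (2 + N)) + 8 * (2 + N)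
    grow = solve-∀

  12n²<n³+8n : 12 ≤ n → 12 * (n * n) < n * n * n + 8 * n
  12n²<n³+8n 12≤n = begin-strict
      12 * (n * n)       ≤⟨ *-monoˡ-≤ (n * n) 12≤n ⟩
      n * (n * n)        ≡⟨ *-assoc n n n ⟨
      n * n * n          <⟨ m<m+n (n * n * n) (>-nonZero⁻¹ (8 * n) {{m*n≢0 8 n}}) ⟩
      n * n * n + 8 * n  ∎
    where open ≤-Reasoning

  n⁴<∑decay : 12 ≤ n → n⁴ < ∑ n decay
  n⁴<∑decay 12≤n = *-cancelˡ-< 3 _ _ (+-cancelʳ-< X _ _ (begin-strict
      3 * n⁴ + X
        <⟨ +-monoʳ-< (3 * n⁴) (+-monoʳ-< (3 * (n * n) * n) (12n²<n³+8n 12≤n)) ⟩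
      3 * n⁴ + (3 * (n * n) * n + (n * n * n + 8 * n))
        ≡⟨ collect n ⟩
      3 * (n * n) * (n * n) + 4 * (n * n * n) + 8 * n
        ≡⟨ ∑decay-closedForm n ⟨
      3 * ∑ n decay + 3 * (n * n) * n + 12 * (n * n)
        ≡⟨ +-assoc (3 * ∑ n decay) _ _ ⟩
      3 * ∑ n decay + X ∎))
    where
    open ≤-Reasoning
    X = 3 * (n * n) * n + 12 * (n * n)
    collect : ∀ n → 3 * (n * (n * n * n)) + (3 * (n * n) * n + (n * n * n + 8 * n))
                  ≡ 3 * (n * n) * (n * n) + 4 * (n * n * n) + 8 * n
    collect = solve-∀

  ∑rate< : 12 ≤ n → ∑ n rate < pred n * n⁴
  ∑rate< 12≤n = +-cancelʳ-< n⁴ _ _ (begin-strict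
      ∑ n rate + n⁴           <⟨ +-monoʳ-< (∑ n rate) (n⁴<∑decay 12≤n) ⟩
      ∑ n rate + ∑ n decay    ≡⟨ ∑rate+∑decay n ≤-refl ⟩
      n * n⁴                  ≡⟨ cong (_* n⁴) (suc-pred n) ⟨
      suc (pred n) * n⁴       ≡⟨ +-comm n⁴ (pred n * n⁴) ⟩
      pred n * n⁴ + n⁴        ∎)
    where open ≤-Reasoning

  μℕ-upper : 12 ≤ n → g n < pred n ^ n
  μℕ-upper 12≤n = *-cancelˡ-< (n⁴ ^ n) _ _ (begin-strict
      n⁴ ^ n * g n              ≡⟨ cong (_* g n) (^-distribʳ-* n n³ n) ⟩
      n ^ n * n³ ^ n * g n      ≡⟨ *-assoc (n ^ n) (n³ ^ n) (g n) ⟩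
      n ^ n * (n³ ^ n * g n)    ≤⟨ *-monoʳ-≤ (n ^ n) (μℕ-telescope n ≤-refl) ⟩
      n ^ n * ∏ n rate          ≤⟨ amgm n rate ⟩
      ∑ n rate ^ n              <⟨ ^-monoˡ-< n (∑rate< 12≤n) ⟩
      (pred n * n⁴) ^ n         ≡⟨ ^-distribʳ-* (pred n) n⁴ n ⟩
      pred n ^ n * n⁴ ^ n       ≡⟨ *-comm (pred n ^ n) (n⁴ ^ n) ⟩
      n⁴ ^ n * pred n ^ n       ∎)
    where open ≤-Reasoning

  μ≡μℕ : ∀ m → m ≤ n → μ n m ≡ + g m
  μ≡μℕ zero          _     = refl
  μ≡μℕ (suc zero)    _     = begin
    μterm n 1 0 ℤ.+ (μterm n 1 1 ℤ.+ 0ℤ)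
      ≡⟨ cong₂ (λ a b → a ℤ.+ (b ℤ.+ 0ℤ)) (μterm-zero n 1) (μterm-vanish n 1 1 ≤-refl) ⟩
    + (n * 1 + 0)
      ≡⟨ cong +_ (trans (+-identityʳ (n * 1)) (*-identityʳ n)) ⟩
    + n ∎
    where open ≡-Reasoning
  μ≡μℕ (suc (suc m)) 2+m≤n = begin
    μ n (2 + m)
      ≡⟨ μ-rec n m ⟩
    + n ℤ.* μ n (1 + m) ℤ.- + c ℤ.* μ n m
      ≡⟨ cong₂ (λ a b → + n ℤ.* a ℤ.- + c ℤ.* b)
               (μ≡μℕ (suc m) (<⇒≤ 2+m≤n)) (μ≡μℕ m (m+n≤o⇒n≤o 2 2+m≤n)) ⟩
    + n ℤ.* + g (suc m) ℤ.- + c ℤ.* + g m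
      ≡⟨ cong₂ ℤ._-_ (ℤ.pos-* n (g (suc m))) (ℤ.pos-* c (g m)) ⟨
    + (n * g (suc m)) ℤ.- + (c * g m)
      ≡⟨ ℤ.[+m]-[+n]≡m⊖n (n * g (suc m)) (c * g m) ⟩
    n * g (suc m) ℤ.⊖ c * g m
      ≡⟨ ℤ.⊖-≥ (μℕ-no-truncation m 2+m≤n) ⟩
    + g (2 + m) ∎
    where
    open ≡-Reasoning
    c = 2 * suc m

Claim : ℕ → Set
Claim d = (+ 0 ℤ.< scaledMuK (suc d)) × (scaledMuK (suc d) ℤ.< + (d ^ suc d))

claim? : ∀ d → Dec (Claim d)
claim? d = (+ 0 ℤ.<? scaledMuK (suc d)) ×-dec (scaledMuK (suc d) ℤ.<? + (d ^ suc d))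

claim-small : ∀ d → 4 ≤ d → d ≤ 10 → Claim d
claim-small d 4≤d d≤10 = subst Claim (m+[n∸m]≡n 4≤d)
  (subst (Claim ∘ _+_ 4) (toℕ-fromℕ< d∸4<7) (evaluated (fromℕ< d∸4<7)))
  where
  evaluated : ∀ (i : Fin 7) → Claim (4 + toℕ i)
  evaluated = toWitness {a? = all? (λ i → claim? (4 + toℕ i))} tt
  d∸4<7 : d ∸ 4 < 7
  d∸4<7 = s≤s (∸-monoˡ-≤ 4 d≤10)

claim-large : ∀ d → 11 ≤ d → Claim d
claim-large d 11≤d =
  subst (λ x → (+ 0 ℤ.< x) × (x ℤ.< + (d ^ suc d))) (sym scaledMuK≡μℕ)
        (ℤ.+<+ (μℕ-pos (suc d) ≤-refl) , ℤ.+<+ (μℕ-upper (s≤s 11≤d)))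
  where
  open Bounds (suc d) (≤-trans (m≤m+n 8 4) (s≤s 11≤d))
  scaledMuK≡μℕ : scaledMuK (suc d) ≡ + μℕ (suc d) (suc d)
  scaledMuK≡μℕ = trans (scaledMuK≡μ (suc d)) (μ≡μℕ (suc d) ≤-refl)

lemma3p2 : (d : ℕ) → 4 ≤ d →
    (+ 0 ℤ.< scaledMuK (suc d)) × (scaledMuK (suc d) ℤ.< + (d ^ suc d))
lemma3p2 d 4≤d with d ≤? 10
... | yes d≤10 = claim-small d 4≤d d≤10
... | no  d≰10 = claim-large d (≰⇒> d≰10)
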